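{- Let $F,R,H$ be binary relation symbols and let $\varphi_{\mathit{func}}$ be the sentence $\forall x\,\big(x=x\to[(\forall y\,(F(x,y)\to R(x,y)))\wedge\exists^{=50\%}_R y\,(R(x,y)\wedge H(x,y))\wedge(\forall y\,(F(x,y)\to(\neg H(x,y)\vee x=y)))\wedge\exists^{=50\%}_R y\,(R(x,y)\wedge((H(x,y)\wedge x\neq y)\vee F(x,y)))]\big)$. Then for every finite model $\mathcal{M}$ of $\varphi_{\mathit{func}}$, the relation $F^{\mathcal{M}}$ is functional, i.e. every element has at most one $F^{\mathcal{M}}$-successor.
   Context: Local percentage quantifier semantics: $\mathcal{M},x/a\models\exists^{=q\%}_R y\,\psi(x,y)$ iff the number of $b$ with $(a,b)\in R^{\mathcal{M}}$ and $\mathcal{M},x/a,y/b\models\psi$ equals $\frac{q}{100}$ times the number of $b$ with $(a,b)\in R^{\mathcal{M}}$. Structures have finite domains. -}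

module Defs where

open import Data.Nat using (ℕ; _*_)
open import Data.Bool using (Bool; true; false; _∧_; _∨_; not; T)
open import Data.Fin using (Fin)
open import Data.Fin.Properties using (_≟_)
open import Data.List using (List; filter; length)
open import Data.List using (allFin)
open import Relation.Nullary.Decidable using (does; ⌊_⌋)
open import Relation.Binary.PropositionalEquality using (_≡_)
open import Data.Product using (_×_)

-- Relations are given by their
-- characteristic functions (finite structures, so relations are decidable).
record Structure : Set where
  field
    n : ℕ
    F R H : Fin n → Fin n → Bool

open Structure public

count : {n : ℕ} → (Fin n → Bool) → ℕ
count {n} p = length (filter (λ b → T? (p b)) (allFin n))
  where
  open import Data.Bool.Properties using (T?)

-- Local percentage quantifier  ∃^{=q%}_R y ψ(x,y)  at x/a:
-- #{b | R(a,b) ∧ ψ(a,b)} = (q/100) · #{b | R(a,b)},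
-- stated without division as  100 · #{…ψ…} = q · #{…R…}.
PercentR : (M : Structure) → ℕ → Fin (n M) → (Fin (n M) → Bool) → Set
PercentR M q a ψ =
  100 * count (λ b → R M a b ∧ ψ b) ≡ q * count (λ b → R M a b)

_=ᵇ_ : {n : ℕ} → Fin n → Fin n → Bool
x =ᵇ y = ⌊ x ≟ y ⌋

SatFunc : Structure → Set
SatFunc M = (a : Fin (n M)) → (a ≡ a) →
    ((b : Fin (n M)) → T (F M a b) → T (R M a b))
  × PercentR M 50 a (λ b → R M a b ∧ H M a b)
  × ((b : Fin (n M)) → T (F M a b) → T (not (H M a b) ∨ (a =ᵇ b)))
  × PercentR M 50 a (λ b → R M a b ∧ ((H M a b ∧ not (a =ᵇ b)) ∨ F M a b))

Functional : Structure → Set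
Functional M = (a b c : Fin (n M)) → T (F M a b) → T (F M a c) → b ≡ c

-- Fix a and compare the two 50% clauses: both count exactly half of the
-- R-successors of a, so #(R ∧ H) = #(R ∧ ((H ∧ y ≠ a) ∨ F)). Every F-successor y
-- is an R-successor, and one with y ≠ a is not an H-successor; so pointwise
-- [R ∧ H] + [F] ≤ [R ∧ ((H ∧ y ≠ a) ∨ F)] + [y = a]. Summing over y gives
-- #F ≤ #{y | y = a} = 1.
module Submission where

open import Defs
open import Data.Nat using (ℕ; zero; suc; _+_; _≤_; z≤n; s≤s)
open import Data.Nat.Properties
  using ( ≤-refl; ≤-trans; m≤m+n; +-mono-≤; +-monoˡ-≤; +-cancelˡ-≤; +-identityʳ
        ; *-cancelˡ-≡; +-commutativeSemigroup; module ≤-Reasoning)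
open import Algebra.Properties.CommutativeSemigroup +-commutativeSemigroup using (interchange)
open import Data.Bool using (Bool; true; false; _∧_; _∨_; not; T)
open import Data.Bool.Properties using (T?)
open import Data.Fin using (Fin; zero; suc)
open import Data.Fin.Properties using (_≟_)
open import Data.List using (filter; length; tabulate)
open import Data.Product using (_,_)
open import Data.Unit using (tt)
open import Data.Empty using (⊥-elim)
open import Function using (_∘_)
open import Relation.Nullary using (¬_; yes; no)
open import Relation.Binary.PropositionalEquality
  using (_≡_; _≢_; refl; sym; trans; cong; cong₂; subst₂; module ≡-Reasoning)

χ : Bool → ℕ
χ true  = 1
χ false = 0

χ-T : ∀ {b} → T b → 1 ≤ χ b
χ-T {true} _ = s≤s z≤n

length-filter-tabulate : ∀ {A : Set} {m} (p : A → Bool) (f : Fin m → A) →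
  length (filter (λ x → T? (p x)) (tabulate f)) ≡ count (p ∘ f)
length-filter-tabulate {m = zero}  p f = refl
length-filter-tabulate {m = suc m} p f
  with p (f zero)
     | length-filter-tabulate p (f ∘ suc)
     | length-filter-tabulate (p ∘ f) suc
... | true  | ih | ih′ = cong suc (trans ih (sym ih′))
... | false | ih | ih′ = trans ih (sym ih′)

count-suc : ∀ {n} (p : Fin (suc n) → Bool) → count p ≡ χ (p zero) + count (p ∘ suc)
count-suc p with p zero | length-filter-tabulate p suc
... | true  | eq = cong suc eq
... | false | eq = eq

count-cong : ∀ {n} {p q : Fin n → Bool} → (∀ x → p x ≡ q x) → count p ≡ count q
count-cong {zero}          eq = refl
count-cong {suc n} {p} {q} eq = begin
  count p                      ≡⟨ count-suc p ⟩
  χ (p zero) + count (p ∘ suc) ≡⟨ cong₂ _+_ (cong χ (eq zero)) (count-cong (eq ∘ suc)) ⟩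
  χ (q zero) + count (q ∘ suc) ≡⟨ sym (count-suc q) ⟩
  count q                      ∎
  where open ≡-Reasoning

count-false : ∀ n → count {n} (λ _ → false) ≡ 0
count-false zero    = refl
count-false (suc n) = trans (count-suc {n} (λ _ → false)) (count-false n)

suc-=ᵇ-suc : ∀ {n} (a y : Fin n) → (suc a =ᵇ suc y) ≡ (a =ᵇ y)
suc-=ᵇ-suc a y with a ≟ y
... | yes _ = refl
... | no  _ = refl

count-≡ : ∀ {n} (a : Fin n) → count (a =ᵇ_) ≡ 1
count-≡ {suc n} zero    = trans (count-suc {n} (zero =ᵇ_)) (cong suc (count-false n))
count-≡ {suc n} (suc a) = begin
  count (suc a =ᵇ_)            ≡⟨ count-suc (suc a =ᵇ_) ⟩
  count (λ y → suc a =ᵇ suc y) ≡⟨ count-cong (suc-=ᵇ-suc a) ⟩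
  count (a =ᵇ_)                ≡⟨ count-≡ a ⟩
  1                            ∎
  where open ≡-Reasoning

count-mono₂ : ∀ {n} (p q r s : Fin n → Bool) →
  (∀ x → χ (p x) + χ (q x) ≤ χ (r x) + χ (s x)) →
  count p + count q ≤ count r + count s
count-mono₂ {zero}  p q r s le = z≤n
count-mono₂ {suc n} p q r s le = begin
  count p + count q
    ≡⟨ cong₂ _+_ (count-suc p) (count-suc q) ⟩
  (χ (p zero) + count (p ∘ suc)) + (χ (q zero) + count (q ∘ suc))
    ≡⟨ interchange (χ (p zero)) _ _ _ ⟩
  (χ (p zero) + χ (q zero)) + (count (p ∘ suc) + count (q ∘ suc))
    ≤⟨ +-mono-≤ (le zero) (count-mono₂ (p ∘ suc) (q ∘ suc) (r ∘ suc) (s ∘ suc) (le ∘ suc)) ⟩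
  (χ (r zero) + χ (s zero)) + (count (r ∘ suc) + count (s ∘ suc))
    ≡⟨ interchange (χ (r zero)) _ _ _ ⟩
  (χ (r zero) + count (r ∘ suc)) + (χ (s zero) + count (s ∘ suc))
    ≡⟨ sym (cong₂ _+_ (count-suc r) (count-suc s)) ⟩
  count r + count s ∎
  where open ≤-Reasoning

two-witnesses⇒2≤count : ∀ {n} (p : Fin n → Bool) {b c : Fin n} →
  b ≢ c → T (p b) → T (p c) → 2 ≤ count p
two-witnesses⇒2≤count {n} p {b} {c} b≢c pb pc =
  subst₂ _≤_ (cong₂ _+_ (count-≡ b) (count-≡ c)) (trans (cong (count p +_) (count-false n)) (+-identityʳ _))
    (count-mono₂ (b =ᵇ_) (c =ᵇ_) p (λ _ → false) pointwise)
  where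
  pointwise : ∀ y → χ (b =ᵇ y) + χ (c =ᵇ y) ≤ χ (p y) + χ false
  pointwise y with b ≟ y | c ≟ y
  ... | yes refl | yes refl = ⊥-elim (b≢c refl)
  ... | yes refl | no  _    = +-monoˡ-≤ 0 (χ-T pb)
  ... | no  _    | yes refl = +-monoˡ-≤ 0 (χ-T pc)
  ... | no  _    | no  _    = z≤n

count≤1⇒unique : ∀ {n} (p : Fin n → Bool) → count p ≤ 1 →
  ∀ {b c} → T (p b) → T (p c) → b ≡ c
count≤1⇒unique p count≤1 {b} {c} pb pc with b ≟ c
... | yes b≡c = b≡c
... | no  b≢c = ⊥-elim (2≰1 (≤-trans (two-witnesses⇒2≤count p b≢c pb pc) count≤1))
  where
  2≰1 : ¬ 2 ≤ 1
  2≰1 (s≤s ())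

PercentR-count-≡ : ∀ M {q a} {ψ ψ′ : Fin (n M) → Bool} →
  PercentR M q a ψ → PercentR M q a ψ′ →
  count (λ b → R M a b ∧ ψ b) ≡ count (λ b → R M a b ∧ ψ′ b)
PercentR-count-≡ M ψ% ψ′% = *-cancelˡ-≡ _ _ 100 (trans ψ% (sym ψ′%))

-- r, h, f, d stand for R a y, H a y, F a y and a = y; R is doubled because
-- PercentR conjoins it with the quantified formula.
clause-balance : ∀ r h f d → (T f → T r) → (T f → T (not h ∨ d)) →
  χ (r ∧ (r ∧ h)) + χ f ≤ χ (r ∧ (r ∧ ((h ∧ not d) ∨ f))) + χ d
clause-balance false h     false d     _   _      = z≤n
clause-balance false h     true  d     f⇒r _      = ⊥-elim (f⇒r tt)
clause-balance true  false f     d     _   _      = m≤m+n (χ f) (χ d)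
clause-balance true  true  false false _   _      = ≤-refl
clause-balance true  true  false true  _   _      = ≤-refl
clause-balance true  true  true  false _   f⇒¬h∨d = ⊥-elim (f⇒¬h∨d tt)
clause-balance true  true  true  true  _   _      = ≤-refl

SatFunc⇒count-F≤1 : ∀ M → SatFunc M → ∀ a → count (F M a) ≤ 1
SatFunc⇒count-F≤1 M sat a with sat a refl
... | F⇒R , half-H , F⇒¬H∨≡ , half-H∨F = +-cancelˡ-≤ (count R∧H) _ _ (begin
  count R∧H + count (F M a)
    ≤⟨ count-mono₂ R∧H (F M a) R∧H∨F (a =ᵇ_)
         (λ y → clause-balance (R M a y) (H M a y) (F M a y) (a =ᵇ y) (F⇒R y) (F⇒¬H∨≡ y)) ⟩
  count R∧H∨F + count (a =ᵇ_)
    ≡⟨ cong₂ _+_ (sym (PercentR-count-≡ M {50} {a} half-H half-H∨F)) (count-≡ a) ⟩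
  count R∧H + 1 ∎)
  where
  open ≤-Reasoning
  R∧H R∧H∨F : Fin (n M) → Bool
  R∧H   y = R M a y ∧ (R M a y ∧ H M a y)
  R∧H∨F y = R M a y ∧ (R M a y ∧ ((H M a y ∧ not (a =ᵇ y)) ∨ F M a y))

lemma20 : (M : Structure) → SatFunc M → Functional M
lemma20 M sat a b c = count≤1⇒unique (F M a) (SatFunc⇒count-F≤1 M sat a)
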